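{- Let $(a,b)$ and $(a',b)$ be two different loop-digraphic lists of length $n$ such that $a$ is obtained from $a'$ by a unit $(i,j)$-transfer, and assume $M_{i,j}(a',b)\ne\emptyset$. Then $$\Big|\bigcup_{G'\in M_{i,j}(a',b)}\mathrm{Shift}_{i,j}(G',(a,b))\Big|>|M_{i,j}(a',b)|.$$
   Context: $(a,b)$ denotes $((a_1,b_1),\dots,(a_n,b_n))$ with nonnegative integers. A loop-digraph realization of $(a,b)$ is a digraph $G$ with arc set $A(G)$ on vertices $1,\dots,n$, without multiple arcs and at most one loop per vertex, with indegree $a_i$ and outdegree $b_i$ at vertex $i$; adjacency matrix $A_{ki}=1$ iff $(k,i)\in A(G)$. $R_1(a,b)$ is the set of loop-digraph realizations; $(a,b)$ is loop-digraphic if $R_1(a,b)\neq\emptyset$. Unit $(i,j)$-transfer: for $i<j$ with $a'_i\ge a'_j+2$, $a=a'-e_i+e_j$. An $(i,j)$-shift on $G'\in R_1(a',b)$ replaces, for one $k$ with $(k,i)\in A(G')$ and $(k,j)\notin A(G')$, the arc $(k,i)$ by $(k,j)$; $\mathrm{Shift}_{i,j}(G',(a,b))$ is the set of realizations of $(a,b)$ obtained from $G'$ by a single $(i,j)$-shift. Two realizations $G'_1,G'_2\in R_1(a',b)$ are $(i,j)$-adjacent if there are $k\ne k'$ with $A(G'_1)\Delta A(G'_2)=\{(k,i),(k',j),(k,j),(k',i)\}$, $(k,i),(k',j)\in A(G'_1)\setminus A(G'_2)$, $(k,j),(k',i)\in A(G'_2)\setminus A(G'_1)$. $M_{i,j}(a',b)$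 is the set of $G'\in R_1(a',b)$ having at least one $(i,j)$-adjacent realization in $R_1(a',b)$. -}

module Defs where

open import Data.Nat using (ℕ; zero; suc; _+_; _∸_; _≤_; _≟_)
open import Data.Bool using (Bool; true; false; _∧_; _∨_; not; if_then_else_; T)
open import Data.Fin using (Fin; _<_)
import Data.Fin as F
open import Data.Vec using (Vec; []; _∷_; lookup; updateAt)
open import Data.List using (List; []; _∷_; map; concatMap; allFin; length; filterᵇ)
open import Data.Nat.ListAction using (sum)
open import Data.Bool.ListAction using (any; all)
open import Data.Product using (_×_)
open import Relation.Binary.PropositionalEquality using (_≡_)
open import Relation.Nullary.Decidable using (⌊_⌋)

-- A loop-digraph on vertices Fin n (= 1..n) is given by its 0/1 adjacency
-- matrix: entry G k i = true iff (k,i) is an arc. This encodes exactly the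
-- digraphs without multiple arcs and with at most one loop per vertex.
Mat : ℕ → Set
Mat n = Vec (Vec Bool n) n

entry : ∀ {n} → Mat n → Fin n → Fin n → Bool
entry G k i = lookup (lookup G k) i

-- finite enumeration (without repetitions) of all vectors / matrices
allVecs : ∀ {A : Set} → List A → (m : ℕ) → List (Vec A m)
allVecs xs zero    = [] ∷ []
allVecs xs (suc m) = concatMap (λ x → map (x ∷_) (allVecs xs m)) xs

allMats : (n : ℕ) → List (Mat n)
allMats n = allVecs (allVecs (true ∷ false ∷ []) n) n

b2n : Bool → ℕ
b2n true  = 1
b2n false = 0

indeg : ∀ {n} → Mat n → Fin n → ℕ
indeg {n} G i = sum (map (λ k → b2n (entry G k i)) (allFin n))

outdeg : ∀ {n} → Mat n → Fin n → ℕ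
outdeg {n} G k = sum (map (λ i → b2n (entry G k i)) (allFin n))

_==_ : ℕ → ℕ → Bool
x == y = ⌊ x ≟ y ⌋

_=ᶠ_ : ∀ {n} → Fin n → Fin n → Bool
x =ᶠ y = ⌊ x F.≟ y ⌋

_=ᵇ_ : Bool → Bool → Bool
x =ᵇ y = ⌊ x Data.Bool.≟ y ⌋

realizes : ∀ {n} → Vec ℕ n → Vec ℕ n → Mat n → Bool
realizes {n} a b G =
  all (λ i → (indeg G i == lookup a i) ∧ (outdeg G i == lookup b i)) (allFin n)

LoopDigraphic : ∀ {n} → Vec ℕ n → Vec ℕ n → Set
LoopDigraphic {n} a b = Data.Product.Σ (Mat n) (λ G → T (realizes a b G))

UnitTransfer : ∀ {n} → Fin n → Fin n → Vec ℕ n → Vec ℕ n → Set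
UnitTransfer i j a' a =
  (i < j) × (lookup a' j + 2 ≤ lookup a' i) ×
  (a ≡ updateAt (updateAt a' i (λ x → x ∸ 1)) j suc)

matEq : ∀ {n} → Mat n → Mat n → Bool
matEq {n} G H = all (λ x → all (λ y → entry G x y =ᵇ entry H x y) (allFin n)) (allFin n)

setEntry : ∀ {n} → Mat n → Fin n → Fin n → Bool → Mat n
setEntry G k i v = updateAt G k (λ row → updateAt row i (λ _ → v))

shiftAt : ∀ {n} → Mat n → Fin n → Fin n → Fin n → Mat n
shiftAt G' i j k = setEntry (setEntry G' k i false) k j true

inShift : ∀ {n} → Fin n → Fin n → Vec ℕ n → Vec ℕ n → Mat n → Mat n → Bool
inShift {n} i j a b G' G =
  realizes a b G ∧
  any (λ k → entry G' k i ∧ not (entry G' k j) ∧ matEq G (shiftAt G' i j k)) (allFin n)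

adjacentVia : ∀ {n} → Fin n → Fin n → Mat n → Mat n → Fin n → Fin n → Bool
adjacentVia {n} i j G₁ G₂ k k' =
  not (k =ᶠ k') ∧
  all (λ x → all (λ y →
        not (entry G₁ x y =ᵇ entry G₂ x y) =ᵇ
          (((x =ᶠ k) ∧ (y =ᶠ i)) ∨ ((x =ᶠ k') ∧ (y =ᶠ j)) ∨
           ((x =ᶠ k) ∧ (y =ᶠ j)) ∨ ((x =ᶠ k') ∧ (y =ᶠ i))))
      (allFin n)) (allFin n) ∧
  (entry G₁ k i ∧ not (entry G₂ k i)) ∧ (entry G₁ k' j ∧ not (entry G₂ k' j)) ∧
  (entry G₂ k j ∧ not (entry G₁ k j)) ∧ (entry G₂ k' i ∧ not (entry G₁ k' i))

adjacent : ∀ {n} → Fin n → Fin n → Mat n → Mat n → Bool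
adjacent {n} i j G₁ G₂ =
  any (λ k → any (λ k' → adjacentVia i j G₁ G₂ k k') (allFin n)) (allFin n)

inM : ∀ {n} → Fin n → Fin n → Vec ℕ n → Vec ℕ n → Mat n → Bool
inM {n} i j a' b G' =
  realizes a' b G' ∧ any (λ G₂ → realizes a' b G₂ ∧ adjacent i j G' G₂) (allMats n)

cardM : ∀ {n} → Fin n → Fin n → Vec ℕ n → Vec ℕ n → ℕ
cardM {n} i j a' b = length (filterᵇ (inM i j a' b) (allMats n))

cardShiftUnion : ∀ {n} → Fin n → Fin n → Vec ℕ n → Vec ℕ n → Vec ℕ n → ℕ
cardShiftUnion {n} i j a' a b =
  length (filterᵇ (λ G → any (λ G' → inM i j a' b G' ∧ inShift i j a b G' G) (allMats n))
                  (allMats n))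

-- Sort the matrices by the number c of rows k carrying both arcs (k,i) and (k,j).
-- Toggling row k, i.e. flipping its entries in columns i and j, is an involution of the
-- set of all matrices, and on a row carrying exactly one of the two arcs it is the
-- (i,j)-shift or its inverse. It matches the pairs (G′,k) with G′ ∈ M_{i,j}(a′,b) in
-- stratum c and (k,i) ∈ A(G′) ∌ (k,j) with the pairs (G,k) with G in the union of the
-- shift sets, in stratum c, and (k,j) ∈ A(G) ∌ (k,i). In stratum c every G′ has
-- a′_i − c such rows and every G has a_j − c, so |M_c| (a′_i − c) = |U_c| (a_j − c);
-- as a_j = a′_j + 1 < a′_i, this forces |M_c| ≤ |U_c|, strictly when M_c ≠ ∅.

module Submission where

open import Defs
open import Data.Nat using (ℕ; _<_)
open import Data.Fin using (Fin)
open import Data.Vec using (Vec)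
open import Data.Bool using (T)
open import Data.Product using (Σ)
open import Relation.Binary.PropositionalEquality using (_≡_; _≢_)

open import Algebra.Properties.CommutativeSemigroup using (interchange)
open import Data.Bool using (Bool; true; false; not; _∧_; _∨_; _xor_)
open import Data.Bool.Properties using (T-≡; T-not-≡; T-∧; ∧-zeroʳ; ∧-identityʳ; not-involutive; xor-assoc; xor-same)
open import Data.Empty using (⊥-elim)
open import Data.Fin using (zero; suc; toℕ; fromℕ<) renaming (_≟_ to _≟ᶠ_)
import Data.Fin.Properties as Fin
open import Data.List using (List; []; _∷_; _++_; map; concatMap; allFin; tabulate; length; filterᵇ)
open import Data.List.Properties using (map-++; map-tabulate; tabulate-cong; length-tabulate)
open import Data.List.Membership.Propositional using (_∈_; lose)
open import Data.List.Membership.Propositional.Properties using (∈-allFin; ∈-map⁺; ∈-concatMap⁺)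
open import Data.List.Relation.Unary.All as All using ()
open import Data.List.Relation.Unary.All.Properties using (all⁺; all⁻)
open import Data.List.Relation.Unary.Any as Any using (here; there; satisfied)
open import Data.List.Relation.Unary.Any.Properties using (any⁺; any⁻)
open import Data.Bool.ListAction using (any; all)
open import Data.Nat using (zero; suc; _+_; _*_; _∸_; _≤_; z≤n; s≤s; >-nonZero)
open import Data.Nat.ListAction using (sum)
open import Data.Nat.ListAction.Properties using (sum-++)
open import Data.Nat.Properties hiding (_≟_)
import Data.Nat.Properties as ℕ
open import Data.Product using (_×_; _,_; proj₁; proj₂; Σ-syntax)
open import Data.Vec using ([]; _∷_; lookup; updateAt)
open import Data.Vec.Properties using (lookup∘updateAt; lookup∘updateAt′; tabulate∘lookup)
import Data.Vec.Properties as Vec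
open import Function using (_∘_; _⇔_; mk⇔; Equivalence)
open import Relation.Binary.PropositionalEquality
  using (refl; sym; trans; cong; cong₂; subst; module ≡-Reasoning)
open import Relation.Nullary using (¬_; Dec; yes; no)
open import Relation.Nullary.Decidable using (isYes; isYes≗does; dec-true; dec-false; toWitness; fromWitness)

open Equivalence using (to; from)

variable
  A : Set
  n : ℕ

∑ : List A → (A → ℕ) → ℕ
∑ xs f = sum (map f xs)

∑-cong : ∀ (xs : List A) {f g : A → ℕ} → (∀ x → f x ≡ g x) → ∑ xs f ≡ ∑ xs g
∑-cong []       f≗g = refl
∑-cong (x ∷ xs) f≗g = cong₂ _+_ (f≗g x) (∑-cong xs f≗g)

∑-distrib-+ : ∀ (xs : List A) f g → ∑ xs (λ x → f x + g x) ≡ ∑ xs f + ∑ xs g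
∑-distrib-+ []       f g = refl
∑-distrib-+ (x ∷ xs) f g =
  trans (cong (f x + g x +_) (∑-distrib-+ xs f g))
        (interchange +-commutativeSemigroup (f x) (g x) (∑ xs f) (∑ xs g))

∑-*ʳ : ∀ (xs : List A) f c → ∑ xs (λ x → f x * c) ≡ ∑ xs f * c
∑-*ʳ []       f c = refl
∑-*ʳ (x ∷ xs) f c = trans (cong (f x * c +_) (∑-*ʳ xs f c)) (sym (*-distribʳ-+ c (f x) _))

∑-zero : ∀ (xs : List A) → ∑ xs (λ _ → 0) ≡ 0
∑-zero []       = refl
∑-zero (x ∷ xs) = ∑-zero xs

∑-swap : ∀ {B : Set} (xs : List A) (ys : List B) (f : A → B → ℕ) →
  ∑ xs (λ x → ∑ ys (f x)) ≡ ∑ ys (λ y → ∑ xs (λ x → f x y))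
∑-swap []       ys f = sym (∑-zero ys)
∑-swap (x ∷ xs) ys f =
  trans (cong (∑ ys (f x) +_) (∑-swap xs ys f)) (sym (∑-distrib-+ ys (f x) _))

∑-map : ∀ {B : Set} (xs : List A) (g : A → B) f → ∑ (map g xs) f ≡ ∑ xs (f ∘ g)
∑-map []       g f = refl
∑-map (x ∷ xs) g f = cong (f (g x) +_) (∑-map xs g f)

∑-concatMap : ∀ {B : Set} (xs : List A) (g : A → List B) f →
  ∑ (concatMap g xs) f ≡ ∑ xs (λ x → ∑ (g x) f)
∑-concatMap []       g f = refl
∑-concatMap (x ∷ xs) g f = begin
  sum (map f (g x ++ concatMap g xs))       ≡⟨ cong sum (map-++ f (g x) _) ⟩
  sum (map f (g x) ++ map f (concatMap g xs)) ≡⟨ sum-++ (map f (g x)) _ ⟩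
  ∑ (g x) f + ∑ (concatMap g xs) f           ≡⟨ cong (∑ (g x) f +_) (∑-concatMap xs g f) ⟩
  ∑ (g x) f + ∑ xs (λ y → ∑ (g y) f)         ∎
  where open ≡-Reasoning

∑-mono-≤ : ∀ (xs : List A) {f g : A → ℕ} → (∀ x → f x ≤ g x) → ∑ xs f ≤ ∑ xs g
∑-mono-≤ []       f≤g = z≤n
∑-mono-≤ (x ∷ xs) f≤g = +-mono-≤ (f≤g x) (∑-mono-≤ xs f≤g)

∑-mono-< : ∀ {xs : List A} {f g : A → ℕ} {x} →
  (∀ y → f y ≤ g y) → x ∈ xs → f x < g x → ∑ xs f < ∑ xs g
∑-mono-< {xs = _ ∷ xs} f≤g (here refl) fx<gx = +-mono-<-≤ fx<gx (∑-mono-≤ xs f≤g)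
∑-mono-< {xs = y ∷ _}  f≤g (there x∈) fx<gx = +-mono-≤-< (f≤g y) (∑-mono-< f≤g x∈ fx<gx)

∈⇒≤∑ : ∀ {xs : List A} (f : A → ℕ) {x} → x ∈ xs → f x ≤ ∑ xs f
∈⇒≤∑ {xs = y ∷ xs} f (here refl) = m≤m+n (f y) _
∈⇒≤∑ {xs = y ∷ xs} f (there x∈) = ≤-trans (∈⇒≤∑ f x∈) (m≤n+m _ (f y))

∑-allFin : ∀ (f : Fin n → ℕ) → ∑ (allFin n) f ≡ sum (tabulate f)
∑-allFin f = cong sum (map-tabulate (λ x → x) f)

sum-tabulate-point : ∀ {n} (f g : Fin n → ℕ) p → (∀ x → x ≢ p → f x ≡ g x) →
  sum (tabulate f) + g p ≡ sum (tabulate g) + f p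
sum-tabulate-point {suc n} f g zero agree = begin
  f zero + Sf + g zero ≡⟨ cong (λ S → f zero + S + g zero) rest ⟩
  f zero + Sg + g zero ≡⟨ +-comm (f zero + Sg) (g zero) ⟩
  g zero + (f zero + Sg) ≡⟨ cong (g zero +_) (+-comm (f zero) Sg) ⟩
  g zero + (Sg + f zero) ≡⟨ sym (+-assoc (g zero) Sg (f zero)) ⟩
  g zero + Sg + f zero ∎
  where
  open ≡-Reasoning
  Sf = sum (tabulate (f ∘ suc))
  Sg = sum (tabulate (g ∘ suc))
  rest : Sf ≡ Sg
  rest = cong sum (tabulate-cong (λ x → agree (suc x) (λ ())))
sum-tabulate-point {suc n} f g (suc p) agree = begin
  f zero + Sf + g (suc p)   ≡⟨ +-assoc (f zero) Sf _ ⟩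
  f zero + (Sf + g (suc p)) ≡⟨ cong₂ _+_ (agree zero (λ ())) rest ⟩
  g zero + (Sg + f (suc p)) ≡⟨ sym (+-assoc (g zero) Sg _) ⟩
  g zero + Sg + f (suc p)   ∎
  where
  open ≡-Reasoning
  Sf = sum (tabulate (f ∘ suc))
  Sg = sum (tabulate (g ∘ suc))
  rest : Sf + g (suc p) ≡ Sg + f (suc p)
  rest = sum-tabulate-point (f ∘ suc) (g ∘ suc) p (λ x x≢p → agree (suc x) (x≢p ∘ Fin.suc-injective))

isYes-true : ∀ {P : Set} (p? : Dec P) → P → isYes p? ≡ true
isYes-true p? p = trans (isYes≗does p?) (dec-true p? p)

isYes-false : ∀ {P : Set} (p? : Dec P) → ¬ P → isYes p? ≡ false
isYes-false p? ¬p = trans (isYes≗does p?) (dec-false p? ¬p)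

T-ext : ∀ {x y} → (T x → T y) → (T y → T x) → x ≡ y
T-ext {true}  {true}  _  _  = refl
T-ext {true}  {false} x⇒y _ = ⊥-elim (x⇒y _)
T-ext {false} {true}  _ y⇒x = ⊥-elim (y⇒x _)
T-ext {false} {false} _  _  = refl

=ᶠ-≢ : ∀ {x y : Fin n} → x ≢ y → (x =ᶠ y) ≡ false
=ᶠ-≢ {x = x} {y} = isYes-false (x ≟ᶠ y)

=ᶠ-disjoint : ∀ {k k′ : Fin n} x → k ≢ k′ → (x =ᶠ k) ∧ (x =ᶠ k′) ≡ false
=ᶠ-disjoint {k = k} x k≢k′ with x ≟ᶠ k
... | yes refl = =ᶠ-≢ k≢k′
... | no _     = refl

-- Not by refl: isYes of ℕ._≟_ does not compute on open terms.
==-suc : ∀ x y → (suc x == suc y) ≡ (x == y)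
==-suc x y = by-cases (x ℕ.≟ y)
  where
  by-cases : Dec (x ≡ y) → (suc x == suc y) ≡ (x == y)
  by-cases (yes x≡y) = trans (isYes-true _ (cong suc x≡y)) (sym (isYes-true _ x≡y))
  by-cases (no x≢y)  = trans (isYes-false _ (x≢y ∘ suc-injective)) (sym (isYes-false _ x≢y))

∧-congʳ-T : ∀ {x y} z → (T z → x ≡ y) → x ∧ z ≡ y ∧ z
∧-congʳ-T {x} {y} true  x≡y = trans (∧-identityʳ x) (trans (x≡y _) (sym (∧-identityʳ y)))
∧-congʳ-T {x} {y} false _   = trans (∧-zeroʳ x) (sym (∧-zeroʳ y))

not-=ᵇ-xor : ∀ p q u → not ((p xor u) =ᵇ (q xor u)) ≡ p xor q
not-=ᵇ-xor true  true  true  = refl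
not-=ᵇ-xor true  true  false = refl
not-=ᵇ-xor true  false true  = refl
not-=ᵇ-xor true  false false = refl
not-=ᵇ-xor false true  true  = refl
not-=ᵇ-xor false true  false = refl
not-=ᵇ-xor false false true  = refl
not-=ᵇ-xor false false false = refl

xor-disjoint-rows : ∀ X X′ Yi Yj → X ∧ X′ ≡ false →
  (X ∧ (Yi ∨ Yj)) xor (X′ ∧ (Yi ∨ Yj)) ≡ (X ∧ Yi) ∨ (X′ ∧ Yj) ∨ (X ∧ Yj) ∨ (X′ ∧ Yi)
xor-disjoint-rows true  true  _     _     ()
xor-disjoint-rows true  false true  _     _ = refl
xor-disjoint-rows true  false false true  _ = refl
xor-disjoint-rows true  false false false _ = refl
xor-disjoint-rows false true  true  true  _ = refl
xor-disjoint-rows false true  true  false _ = refl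
xor-disjoint-rows false true  false true  _ = refl
xor-disjoint-rows false true  false false _ = refl
xor-disjoint-rows false false _     _     _ = refl

b2n-split-∧ : ∀ u v → b2n u ≡ b2n (u ∧ v) + b2n (u ∧ not v)
b2n-split-∧ true  true  = refl
b2n-split-∧ true  false = refl
b2n-split-∧ false v     = refl

b2n-split-∧ʳ : ∀ u v → b2n v ≡ b2n (u ∧ v) + b2n (not u ∧ v)
b2n-split-∧ʳ true  v = sym (+-identityʳ (b2n v))
b2n-split-∧ʳ false v = refl

length-filterᵇ : ∀ (P : A → Bool) xs → length (filterᵇ P xs) ≡ ∑ xs (b2n ∘ P)
length-filterᵇ P []       = refl
length-filterᵇ P (x ∷ xs) with P x
... | true  = cong suc (length-filterᵇ P xs)
... | false = length-filterᵇ P xs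

∑-b2n≤length : ∀ (P : A → Bool) xs → ∑ xs (b2n ∘ P) ≤ length xs
∑-b2n≤length P []       = z≤n
∑-b2n≤length P (x ∷ xs) with P x
... | true  = s≤s (∑-b2n≤length P xs)
... | false = m≤n⇒m≤1+n (∑-b2n≤length P xs)

∑-b2n>0⇒∃ : ∀ (P : A → Bool) xs → 0 < ∑ xs (b2n ∘ P) → Σ A (T ∘ P)
∑-b2n>0⇒∃ P (x ∷ xs) pos with P x in eq
... | true  = x , from T-≡ eq
... | false = ∑-b2n>0⇒∃ P xs pos

∑-incidences : ∀ {B : Set} (xs : List A) (ys : List B) (P : A → Bool) (Q : A → B → Bool) p →
  (∀ x → T (P x) → ∑ ys (b2n ∘ Q x) ≡ p) →
  ∑ ys (λ y → ∑ xs (λ x → b2n (P x ∧ Q x y))) ≡ ∑ xs (b2n ∘ P) * p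
∑-incidences xs ys P Q p fibre = begin
  ∑ ys (λ y → ∑ xs (λ x → b2n (P x ∧ Q x y))) ≡⟨ sym (∑-swap xs ys _) ⟩
  ∑ xs (λ x → ∑ ys (λ y → b2n (P x ∧ Q x y))) ≡⟨ ∑-cong xs row ⟩
  ∑ xs (λ x → b2n (P x) * p)                    ≡⟨ ∑-*ʳ xs (b2n ∘ P) p ⟩
  ∑ xs (b2n ∘ P) * p                            ∎
  where
  open ≡-Reasoning
  row : ∀ x → ∑ ys (λ y → b2n (P x ∧ Q x y)) ≡ b2n (P x) * p
  row x with P x in eq
  ... | true  = trans (fibre x (from T-≡ eq)) (sym (+-identityʳ p))
  ... | false = ∑-zero ys

sum-tabulate-indicator : ∀ (P : Bool) {m} x → x < m →
  sum (tabulate {n = m} (λ c → b2n (P ∧ (x == toℕ c)))) ≡ b2n P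
sum-tabulate-indicator P {suc m} zero    _ rewrite ∧-identityʳ P | ∧-zeroʳ P =
  trans (cong (b2n P +_) (sum-tabulate-zero m)) (+-identityʳ (b2n P))
  where
  sum-tabulate-zero : ∀ m → sum (tabulate {n = m} (λ _ → 0)) ≡ 0
  sum-tabulate-zero zero    = refl
  sum-tabulate-zero (suc m) = sum-tabulate-zero m
sum-tabulate-indicator P {suc m} (suc x) (s≤s x<m) rewrite ∧-zeroʳ P =
  trans (cong sum (tabulate-cong {n = m} {f = λ c → b2n (P ∧ (suc x == suc (toℕ c)))}
                                 (λ c → cong (λ e → b2n (P ∧ e)) (==-suc x (toℕ c)))))
        (sum-tabulate-indicator P x x<m)

∑-stratify : ∀ (xs : List A) (P : A → Bool) (f : A → ℕ) m → (∀ x → f x < m) →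
  ∑ xs (b2n ∘ P) ≡ ∑ (allFin m) (λ c → ∑ xs (λ x → b2n (P x ∧ (f x == toℕ c))))
∑-stratify xs P f m f<m = begin
  ∑ xs (b2n ∘ P)                                               ≡⟨ ∑-cong xs split ⟩
  ∑ xs (λ x → ∑ (allFin m) (λ c → b2n (P x ∧ (f x == toℕ c)))) ≡⟨ ∑-swap xs (allFin m) _ ⟩
  ∑ (allFin m) (λ c → ∑ xs (λ x → b2n (P x ∧ (f x == toℕ c)))) ∎
  where
  open ≡-Reasoning
  split : ∀ x → b2n (P x) ≡ ∑ (allFin m) (λ c → b2n (P x ∧ (f x == toℕ c)))
  split x = sym (trans (∑-allFin {n = m} _) (sum-tabulate-indicator (P x) (f x) (f<m x)))

balance⇒< : ∀ {m u p q} → m * p ≡ u * q → q < p → 0 < m → m < u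
balance⇒< {m} {u} {p} {q} balance q<p m>0 = *-cancelʳ-< q m u (begin-strict
  m * q <⟨ *-monoʳ-< m ⦃ >-nonZero m>0 ⦄ q<p ⟩
  m * p ≡⟨ balance ⟩
  u * q ∎)
  where open ≤-Reasoning

any-intro : ∀ (p : A → Bool) {xs x} → x ∈ xs → T (p x) → T (any p xs)
any-intro p x∈ px = any⁺ p (lose x∈ px)

any-elim : ∀ (p : A → Bool) xs → T (any p xs) → Σ A (T ∘ p)
any-elim p xs t = satisfied (any⁻ p xs t)

all-allFin-intro : ∀ (p : Fin n → Bool) → (∀ x → T (p x)) → T (all p (allFin n))
all-allFin-intro {n} p px = all⁻ p {xs = allFin n} (All.tabulate (λ {x} _ → px x))

all-allFin-elim : ∀ (p : Fin n → Bool) → T (all p (allFin n)) → ∀ x → T (p x)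
all-allFin-elim p t x = All.lookup (all⁺ p (allFin _) t) (∈-allFin x)

allVecs-complete : ∀ (xs : List A) → (∀ x → x ∈ xs) → ∀ m (v : Vec A m) → v ∈ allVecs xs m
allVecs-complete xs complete zero    []       = here refl
allVecs-complete xs complete (suc m) (x ∷ v) =
  ∈-concatMap⁺ (λ y → map (y ∷_) (allVecs xs m))
    (Any.map (λ { refl → ∈-map⁺ (x ∷_) (allVecs-complete xs complete m v) }) (complete x))

allMats-complete : ∀ (G : Mat n) → G ∈ allMats n
allMats-complete {n} G = allVecs-complete _ (allVecs-complete _ bool-complete n) n G
  where
  bool-complete : ∀ x → x ∈ true ∷ false ∷ []
  bool-complete true  = here refl
  bool-complete false = there (here refl)

∑-allVecs-suc : ∀ (xs : List A) m h →
  ∑ (allVecs xs (suc m)) h ≡ ∑ xs (λ x → ∑ (allVecs xs m) (λ v → h (x ∷ v)))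
∑-allVecs-suc xs m h =
  trans (∑-concatMap xs _ h) (∑-cong xs (λ x → ∑-map (allVecs xs m) (x ∷_) h))

SumInvariant : List A → (A → A) → Set
SumInvariant xs g = ∀ h → ∑ xs (h ∘ g) ≡ ∑ xs h

SumInvariant-∘ : ∀ (xs : List A) {f g} → SumInvariant xs f → SumInvariant xs g → SumInvariant xs (g ∘ f)
SumInvariant-∘ xs {f} {g} inv-f inv-g h = trans (inv-f (h ∘ g)) (inv-g h)

SumInvariant-not : SumInvariant (true ∷ false ∷ []) not
SumInvariant-not h = begin
  h false + (h true + 0) ≡⟨ cong (h false +_) (+-identityʳ (h true)) ⟩
  h false + h true       ≡⟨ +-comm (h false) (h true) ⟩
  h true + h false       ≡⟨ cong (h true +_) (sym (+-identityʳ (h false))) ⟩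
  h true + (h false + 0) ∎
  where open ≡-Reasoning

SumInvariant-updateAt : ∀ (xs : List A) {g} → SumInvariant xs g →
  ∀ m (p : Fin m) → SumInvariant (allVecs xs m) (λ v → updateAt v p g)
SumInvariant-updateAt xs {g} inv-g (suc m) zero h = begin
  ∑ (allVecs xs (suc m)) (λ v → h (updateAt v zero g)) ≡⟨ ∑-allVecs-suc xs m _ ⟩
  ∑ xs (λ x → ∑ (allVecs xs m) (λ v → h (g x ∷ v)))
    ≡⟨ inv-g (λ y → ∑ (allVecs xs m) (λ v → h (y ∷ v))) ⟩
  ∑ xs (λ x → ∑ (allVecs xs m) (λ v → h (x ∷ v)))      ≡⟨ sym (∑-allVecs-suc xs m h) ⟩
  ∑ (allVecs xs (suc m)) h                             ∎
  where open ≡-Reasoning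
SumInvariant-updateAt xs {g} inv-g (suc m) (suc p) h = begin
  ∑ (allVecs xs (suc m)) (λ v → h (updateAt v (suc p) g))        ≡⟨ ∑-allVecs-suc xs m _ ⟩
  ∑ xs (λ x → ∑ (allVecs xs m) (λ v → h (x ∷ updateAt v p g)))
    ≡⟨ ∑-cong xs (λ x → SumInvariant-updateAt xs inv-g m p (λ v → h (x ∷ v))) ⟩
  ∑ xs (λ x → ∑ (allVecs xs m) (λ v → h (x ∷ v)))               ≡⟨ sym (∑-allVecs-suc xs m h) ⟩
  ∑ (allVecs xs (suc m)) h                                      ∎
  where open ≡-Reasoning

vec-ext : ∀ {m} (u v : Vec A m) → (∀ x → lookup u x ≡ lookup v x) → u ≡ v
vec-ext u v u≗v = trans (sym (tabulate∘lookup u)) (trans (Vec.tabulate-cong u≗v) (tabulate∘lookup v))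

mat-ext : ∀ (G H : Mat n) → (∀ x y → entry G x y ≡ entry H x y) → G ≡ H
mat-ext G H G≗H = vec-ext G H (λ x → vec-ext _ _ (G≗H x))

T-matEq : ∀ {G H : Mat n} → T (matEq G H) ⇔ G ≡ H
T-matEq {n} {G} {H} = mk⇔
  (λ t → mat-ext G H (λ x y → toWitness (all-allFin-elim (agree x) (all-allFin-elim _ t x) y)))
  (λ { refl → all-allFin-intro _ (λ x → all-allFin-intro (agree x) (λ y → fromWitness refl)) })
  where
  agree : Fin n → Fin n → Bool
  agree x y = entry G x y =ᵇ entry H x y

updateEntry : Mat n → Fin n → Fin n → (Bool → Bool) → Mat n
updateEntry G k y h = updateAt G k (λ row → updateAt row y h)

module _ (G : Mat n) (k y : Fin n) where

  entry-updateEntry : ∀ h → entry (updateEntry G k y h) k y ≡ h (entry G k y)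
  entry-updateEntry h rewrite lookup∘updateAt k {λ row → updateAt row y h} G =
    lookup∘updateAt y (lookup G k)

  entry-updateEntry-row : ∀ h {x} y′ → x ≢ k → entry (updateEntry G k y h) x y′ ≡ entry G x y′
  entry-updateEntry-row h {x} y′ x≢k = cong (λ row → lookup row y′) (lookup∘updateAt′ x k x≢k G)

  entry-updateEntry-col : ∀ h x {y′} → y′ ≢ y → entry (updateEntry G k y h) x y′ ≡ entry G x y′
  entry-updateEntry-col h x {y′} y′≢y with x ≟ᶠ k
  ... | no x≢k  = entry-updateEntry-row h y′ x≢k
  ... | yes refl rewrite lookup∘updateAt x {λ row → updateAt row y h} G =
    lookup∘updateAt′ y′ y y′≢y (lookup G x)

  updateEntry-cong : ∀ {h h′} → h (entry G k y) ≡ h′ (entry G k y) → updateEntry G k y h ≡ updateEntry G k y h′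
  updateEntry-cong {h} {h′} same = mat-ext _ _ agree
    where
    agree : ∀ x y′ → entry (updateEntry G k y h) x y′ ≡ entry (updateEntry G k y h′) x y′
    agree x y′ with x ≟ᶠ k | y′ ≟ᶠ y
    ... | no x≢k   | _        = trans (entry-updateEntry-row h y′ x≢k) (sym (entry-updateEntry-row h′ y′ x≢k))
    ... | yes refl | yes refl = trans (entry-updateEntry h) (trans same (sym (entry-updateEntry h′)))
    ... | yes refl | no y′≢y  = trans (entry-updateEntry-col h x y′≢y) (sym (entry-updateEntry-col h′ x y′≢y))

module _ (G : Mat n) (k y : Fin n) (h : Bool → Bool) where

  indeg-updateEntry : indeg (updateEntry G k y h) y + b2n (entry G k y) ≡ indeg G y + b2n (h (entry G k y))
  indeg-updateEntry = begin
    indeg (updateEntry G k y h) y + b2n (entry G k y) ≡⟨ cong (_+ _) (∑-allFin new) ⟩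
    sum (tabulate new) + old k
      ≡⟨ sum-tabulate-point new old k (λ x x≢k → cong b2n (entry-updateEntry-row G k y h y x≢k)) ⟩
    sum (tabulate old) + new k
      ≡⟨ cong₂ _+_ (sym (∑-allFin old)) (cong b2n (entry-updateEntry G k y h)) ⟩
    indeg G y + b2n (h (entry G k y))                 ∎
    where
    open ≡-Reasoning
    new old : Fin n → ℕ
    new x = b2n (entry (updateEntry G k y h) x y)
    old x = b2n (entry G x y)

  outdeg-updateEntry : outdeg (updateEntry G k y h) k + b2n (entry G k y) ≡ outdeg G k + b2n (h (entry G k y))
  outdeg-updateEntry = begin
    outdeg (updateEntry G k y h) k + b2n (entry G k y) ≡⟨ cong (_+ _) (∑-allFin new) ⟩
    sum (tabulate new) + old y
      ≡⟨ sum-tabulate-point new old y (λ y′ y′≢y → cong b2n (entry-updateEntry-col G k y h k y′≢y)) ⟩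
    sum (tabulate old) + new y
      ≡⟨ cong₂ _+_ (sym (∑-allFin old)) (cong b2n (entry-updateEntry G k y h)) ⟩
    outdeg G k + b2n (h (entry G k y))                 ∎
    where
    open ≡-Reasoning
    new old : Fin n → ℕ
    new y′ = b2n (entry (updateEntry G k y h) k y′)
    old y′ = b2n (entry G k y′)

  indeg-updateEntry-col : ∀ {y′} → y′ ≢ y → indeg (updateEntry G k y h) y′ ≡ indeg G y′
  indeg-updateEntry-col y′≢y = ∑-cong (allFin n) (λ x → cong b2n (entry-updateEntry-col G k y h x y′≢y))

  outdeg-updateEntry-row : ∀ {x} → x ≢ k → outdeg (updateEntry G k y h) x ≡ outdeg G x
  outdeg-updateEntry-row x≢k = ∑-cong (allFin n) (λ y′ → cong b2n (entry-updateEntry-row G k y h y′ x≢k))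

degree-flip-on : ∀ {d′ d e} → e ≡ false → d′ + b2n e ≡ d + b2n (not e) → d′ ≡ suc d
degree-flip-on {d′} {d} refl eq = trans (sym (+-identityʳ d′)) (trans eq (+-comm d 1))

degree-flip-off : ∀ {d′ d e} → e ≡ true → d′ + b2n e ≡ d + b2n (not e) → suc d′ ≡ d
degree-flip-off {d′} {d} refl eq = trans (+-comm 1 d′) (trans eq (+-identityʳ d))

-- Toggling the arcs (k,i) and (k,j)

module Toggle {i j : Fin n} (i≢j : i ≢ j) where

  j≢i : j ≢ i
  j≢i = i≢j ∘ sym

  toggle : Fin n → Mat n → Mat n
  toggle k G = updateEntry (updateEntry G k i not) k j not

  flips : Fin n → Fin n → Fin n → Bool
  flips k x y = (x =ᶠ k) ∧ ((y =ᶠ i) ∨ (y =ᶠ j))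

  module _ (k : Fin n) (G : Mat n) where

    entry-toggle-i : entry (toggle k G) k i ≡ not (entry G k i)
    entry-toggle-i = trans (entry-updateEntry-col (updateEntry G k i not) k j not k i≢j)
                           (entry-updateEntry G k i not)

    entry-toggle-j : entry (toggle k G) k j ≡ not (entry G k j)
    entry-toggle-j = trans (entry-updateEntry (updateEntry G k i not) k j not)
                           (cong not (entry-updateEntry-col G k i not k j≢i))

    entry-toggle-row : ∀ {x} y → x ≢ k → entry (toggle k G) x y ≡ entry G x y
    entry-toggle-row y x≢k = trans (entry-updateEntry-row (updateEntry G k i not) k j not y x≢k)
                                   (entry-updateEntry-row G k i not y x≢k)

    entry-toggle-col : ∀ x {y} → y ≢ i → y ≢ j → entry (toggle k G) x y ≡ entry G x y
    entry-toggle-col x y≢i y≢j = trans (entry-updateEntry-col (updateEntry G k i not) k j not x y≢j)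
                                       (entry-updateEntry-col G k i not x y≢i)

    entry-toggle : ∀ x y → entry (toggle k G) x y ≡ flips k x y xor entry G x y
    entry-toggle x y with x ≟ᶠ k
    ... | no x≢k   = entry-toggle-row y x≢k
    ... | yes refl with y ≟ᶠ i | y ≟ᶠ j
    ...   | yes refl | _        = entry-toggle-i
    ...   | no _     | yes refl = entry-toggle-j
    ...   | no y≢i   | no y≢j   = entry-toggle-col x y≢i y≢j

  toggle-involutive : ∀ k G → toggle k (toggle k G) ≡ G
  toggle-involutive k G = mat-ext _ _ twice
    where
    twice : ∀ x y → entry (toggle k (toggle k G)) x y ≡ entry G x y
    twice x y = begin
      entry (toggle k (toggle k G)) x y             ≡⟨ entry-toggle k (toggle k G) x y ⟩
      flips k x y xor entry (toggle k G) x y        ≡⟨ cong (flips k x y xor_) (entry-toggle k G x y) ⟩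
      flips k x y xor (flips k x y xor entry G x y) ≡⟨ sym (xor-assoc (flips k x y) _ _) ⟩
      (flips k x y xor flips k x y) xor entry G x y ≡⟨ cong (_xor entry G x y) (xor-same (flips k x y)) ⟩
      entry G x y                                   ∎
      where open ≡-Reasoning

  shiftAt≡toggle : ∀ {k G} → entry G k i ≡ true → entry G k j ≡ false → shiftAt G i j k ≡ toggle k G
  shiftAt≡toggle {k} {G} Gki Gkj = begin
    updateEntry (updateEntry G k i (λ _ → false)) k j (λ _ → true)
      ≡⟨ cong (λ G′ → updateEntry G′ k j (λ _ → true)) (updateEntry-cong G k i (sym (cong not Gki))) ⟩
    updateEntry (updateEntry G k i not) k j (λ _ → true)
      ≡⟨ updateEntry-cong (updateEntry G k i not) k j (sym (cong not (trans (entry-updateEntry-col G k i not k j≢i) Gkj))) ⟩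
    toggle k G
      ∎
    where open ≡-Reasoning

  shiftAt-toggle : ∀ {k G} → entry G k i ≡ false → entry G k j ≡ true → shiftAt (toggle k G) i j k ≡ G
  shiftAt-toggle {k} {G} Gki Gkj =
    trans (shiftAt≡toggle (trans (entry-toggle-i k G) (cong not Gki)) (trans (entry-toggle-j k G) (cong not Gkj)))
          (toggle-involutive k G)

  toggle-adjacent : ∀ {k k′ G} → k ≢ k′ →
    entry G k i ≡ false → entry G k j ≡ true → entry G k′ i ≡ false → entry G k′ j ≡ true →
    T (adjacent i j (toggle k G) (toggle k′ G))
  toggle-adjacent {k} {k′} {G} k≢k′ Gki Gkj Gk′i Gk′j =
    any-intro _ (∈-allFin k) (any-intro _ (∈-allFin k′)
      (from T-∧ (from T-not-≡ (=ᶠ-≢ k≢k′) , from T-∧ (differences ,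
       from T-∧ (arc-pair H-ki H′-ki , from T-∧ (arc-pair H-k′j H′-k′j ,
       from T-∧ (arc-pair H′-kj H-kj , arc-pair H′-k′i H-k′i)))))))
    where
    H-ki : entry (toggle k G) k i ≡ true
    H-ki = trans (entry-toggle-i k G) (cong not Gki)
    H-kj : entry (toggle k G) k j ≡ false
    H-kj = trans (entry-toggle-j k G) (cong not Gkj)
    H-k′i : entry (toggle k G) k′ i ≡ false
    H-k′i = trans (entry-toggle-row k G i (k≢k′ ∘ sym)) Gk′i
    H-k′j : entry (toggle k G) k′ j ≡ true
    H-k′j = trans (entry-toggle-row k G j (k≢k′ ∘ sym)) Gk′j
    H′-ki : entry (toggle k′ G) k i ≡ false
    H′-ki = trans (entry-toggle-row k′ G i k≢k′) Gki
    H′-kj : entry (toggle k′ G) k j ≡ true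
    H′-kj = trans (entry-toggle-row k′ G j k≢k′) Gkj
    H′-k′i : entry (toggle k′ G) k′ i ≡ true
    H′-k′i = trans (entry-toggle-i k′ G) (cong not Gk′i)
    H′-k′j : entry (toggle k′ G) k′ j ≡ false
    H′-k′j = trans (entry-toggle-j k′ G) (cong not Gk′j)
    arc-pair : ∀ {u v} → u ≡ true → v ≡ false → T (u ∧ not v)
    arc-pair refl refl = _
    differ : ∀ x y → not (entry (toggle k G) x y =ᵇ entry (toggle k′ G) x y) ≡
      ((x =ᶠ k) ∧ (y =ᶠ i)) ∨ ((x =ᶠ k′) ∧ (y =ᶠ j)) ∨ ((x =ᶠ k) ∧ (y =ᶠ j)) ∨ ((x =ᶠ k′) ∧ (y =ᶠ i))
    differ x y rewrite entry-toggle k G x y | entry-toggle k′ G x y =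
      trans (not-=ᵇ-xor (flips k x y) (flips k′ x y) (entry G x y))
            (xor-disjoint-rows (x =ᶠ k) (x =ᶠ k′) (y =ᶠ i) (y =ᶠ j) (=ᶠ-disjoint x k≢k′))
    differences = all-allFin-intro _ (λ x → all-allFin-intro _ (λ y → fromWitness (differ x y)))

  toggle-SumInvariant : ∀ k → SumInvariant (allMats n) (toggle k)
  toggle-SumInvariant k = SumInvariant-∘ (allMats n) (flip-invariant i) (flip-invariant j)
    where
    flip-invariant : ∀ y → SumInvariant (allMats n) (λ G → updateEntry G k y not)
    flip-invariant y = SumInvariant-updateAt _ (SumInvariant-updateAt _ SumInvariant-not n y) n k

  module Degrees (k : Fin n) (G : Mat n) (Gki : entry G k i ≡ false) (Gkj : entry G k j ≡ true) where

    halfway-kj : entry (updateEntry G k i not) k j ≡ true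
    halfway-kj = trans (entry-updateEntry-col G k i not k j≢i) Gkj

    indeg-toggle-i : indeg (toggle k G) i ≡ suc (indeg G i)
    indeg-toggle-i = trans (indeg-updateEntry-col (updateEntry G k i not) k j not i≢j)
                           (degree-flip-on Gki (indeg-updateEntry G k i not))

    indeg-toggle-j : suc (indeg (toggle k G) j) ≡ indeg G j
    indeg-toggle-j = trans (degree-flip-off halfway-kj (indeg-updateEntry (updateEntry G k i not) k j not))
                           (indeg-updateEntry-col G k i not j≢i)

    indeg-toggle-col : ∀ {y} → y ≢ i → y ≢ j → indeg (toggle k G) y ≡ indeg G y
    indeg-toggle-col y≢i y≢j = trans (indeg-updateEntry-col (updateEntry G k i not) k j not y≢j)
                                     (indeg-updateEntry-col G k i not y≢i)

    outdeg-toggle : ∀ x → outdeg (toggle k G) x ≡ outdeg G x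
    outdeg-toggle x with x ≟ᶠ k
    ... | no x≢k   = trans (outdeg-updateEntry-row (updateEntry G k i not) k j not x≢k)
                           (outdeg-updateEntry-row G k i not x≢k)
    ... | yes refl = suc-injective
      (trans (degree-flip-off halfway-kj (outdeg-updateEntry (updateEntry G k i not) k j not))
             (degree-flip-on Gki (outdeg-updateEntry G k i not)))

record Realizes (a b : Vec ℕ n) (G : Mat n) : Set where
  field
    indeg≡  : ∀ x → indeg G x ≡ lookup a x
    outdeg≡ : ∀ x → outdeg G x ≡ lookup b x

open Realizes

T-realizes : ∀ {a b} {G : Mat n} → T (realizes a b G) ⇔ Realizes a b G
T-realizes {a = a} {b} {G} = mk⇔
  (λ t → record { indeg≡  = λ x → toWitness (proj₁ (degrees t x))
                ; outdeg≡ = λ x → toWitness (proj₂ (degrees t x)) })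
  (λ r → all-allFin-intro _ (λ x →
           from (T-∧ {indeg G x == lookup a x}) (fromWitness (indeg≡ r x) , fromWitness (outdeg≡ r x))))
  where
  degrees : T (realizes a b G) → ∀ x → T (indeg G x == lookup a x) × T (outdeg G x == lookup b x)
  degrees t x = to (T-∧ {indeg G x == lookup a x}) (all-allFin-elim _ t x)

module Transfer {i j : Fin n} (i≢j : i ≢ j) {a a′ : Vec ℕ n}
    (a≡ : a ≡ updateAt (updateAt a′ i (λ x → x ∸ 1)) j suc) (gap : lookup a′ j + 2 ≤ lookup a′ i) where

  open Toggle i≢j

  lookup-i : lookup a i ≡ lookup a′ i ∸ 1
  lookup-i rewrite a≡ | lookup∘updateAt′ i j {suc} i≢j (updateAt a′ i (λ x → x ∸ 1)) = lookup∘updateAt i a′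

  lookup-j : lookup a j ≡ suc (lookup a′ j)
  lookup-j rewrite a≡ | lookup∘updateAt j {suc} (updateAt a′ i (λ x → x ∸ 1)) =
    cong suc (lookup∘updateAt′ j i j≢i a′)

  lookup-col : ∀ {y} → y ≢ i → y ≢ j → lookup a y ≡ lookup a′ y
  lookup-col {y} y≢i y≢j rewrite a≡ | lookup∘updateAt′ y j {suc} y≢j (updateAt a′ i (λ x → x ∸ 1)) =
    lookup∘updateAt′ y i y≢i a′

  a′ᵢ>0 : 0 < lookup a′ i
  a′ᵢ>0 = ≤-trans (s≤s z≤n) (≤-trans (m≤n+m 2 (lookup a′ j)) gap)

  Realizes-toggle : ∀ {b} k G → entry G k i ≡ false → entry G k j ≡ true →
    Realizes a′ b (toggle k G) ⇔ Realizes a b G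
  Realizes-toggle {b} k G Gki Gkj = mk⇔
    (λ r → record { indeg≡ = indeg-to r ; outdeg≡ = λ x → trans (sym (outdeg-toggle x)) (outdeg≡ r x) })
    (λ r → record { indeg≡ = indeg-from r ; outdeg≡ = λ x → trans (outdeg-toggle x) (outdeg≡ r x) })
    where
    open Degrees k G Gki Gkj
    indeg-to : Realizes a′ b (toggle k G) → ∀ x → indeg G x ≡ lookup a x
    indeg-to r x with x ≟ᶠ i | x ≟ᶠ j
    ... | yes refl | _        = trans (cong (_∸ 1) (sym indeg-toggle-i))
                                      (trans (cong (_∸ 1) (indeg≡ r i)) (sym lookup-i))
    ... | no _     | yes refl = trans (sym indeg-toggle-j) (trans (cong suc (indeg≡ r j)) (sym lookup-j))
    ... | no x≢i   | no x≢j   = trans (sym (indeg-toggle-col x≢i x≢j))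
                                      (trans (indeg≡ r x) (sym (lookup-col x≢i x≢j)))
    indeg-from : Realizes a b G → ∀ x → indeg (toggle k G) x ≡ lookup a′ x
    indeg-from r x with x ≟ᶠ i | x ≟ᶠ j
    ... | yes refl | _        = trans indeg-toggle-i
                                      (trans (cong suc (trans (indeg≡ r i) lookup-i)) (suc-pred _ ⦃ >-nonZero a′ᵢ>0 ⦄))
    ... | no _     | yes refl = suc-injective (trans indeg-toggle-j (trans (indeg≡ r j) lookup-j))
    ... | no x≢i   | no x≢j   = trans (indeg-toggle-col x≢i x≢j) (trans (indeg≡ r x) (lookup-col x≢i x≢j))

-- Membership in M_{i,j}(a′,b) and in the union of the shift sets

inShiftUnion : Fin n → Fin n → Vec ℕ n → Vec ℕ n → Vec ℕ n → Mat n → Bool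
inShiftUnion {n} i j a′ a b G = any (λ G′ → inM i j a′ b G′ ∧ inShift i j a b G′ G) (allMats n)

ShiftedAt : Fin n → Fin n → Mat n → Mat n → Fin n → Set
ShiftedAt i j G′ G k = entry G′ k i ≡ true × entry G′ k j ≡ false × shiftAt G′ i j k ≡ G

module Membership (i j : Fin n) (a′ a b : Vec ℕ n) where

  inM⇒Realizes : ∀ G → T (inM i j a′ b G) → Realizes a′ b G
  inM⇒Realizes G t = to T-realizes (proj₁ (to (T-∧ {realizes a′ b G}) t))

  inM-intro : ∀ G G₂ → Realizes a′ b G → Realizes a′ b G₂ → T (adjacent i j G G₂) → T (inM i j a′ b G)
  inM-intro G G₂ rG rG₂ adj =
    from (T-∧ {realizes a′ b G}) (from T-realizes rG ,
      any-intro _ (allMats-complete G₂) (from (T-∧ {realizes a′ b G₂}) (from T-realizes rG₂ , adj)))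

  T-inShift : ∀ G′ G → T (inShift i j a b G′ G) ⇔ (Realizes a b G × Σ[ k ∈ Fin n ] ShiftedAt i j G′ G k)
  T-inShift G′ G = mk⇔ elim intro
    where
    shifts-at : Fin n → Bool
    shifts-at k = entry G′ k i ∧ not (entry G′ k j) ∧ matEq G (shiftAt G′ i j k)
    elim : T (inShift i j a b G′ G) → Realizes a b G × Σ[ k ∈ Fin n ] ShiftedAt i j G′ G k
    elim t =
      let rG , t-any  = to (T-∧ {realizes a b G}) t
          k , t-k     = any-elim shifts-at (allFin n) t-any
          ki , t-rest = to (T-∧ {entry G′ k i}) t-k
          kj , eq     = to (T-∧ {not (entry G′ k j)}) t-rest
      in to T-realizes rG , k , to T-≡ ki , to T-not-≡ kj , sym (to T-matEq eq)
    intro : Realizes a b G × Σ[ k ∈ Fin n ] ShiftedAt i j G′ G k → T (inShift i j a b G′ G)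
    intro (rG , k , ki , kj , eq) =
      from (T-∧ {realizes a b G}) (from T-realizes rG , any-intro shifts-at (∈-allFin k)
        (from (T-∧ {entry G′ k i}) (from T-≡ ki ,
          from (T-∧ {not (entry G′ k j)}) (from T-not-≡ kj , from T-matEq (sym eq)))))

  T-inShiftUnion : ∀ G →
    T (inShiftUnion i j a′ a b G) ⇔ (Σ[ G′ ∈ Mat n ] (T (inM i j a′ b G′) × T (inShift i j a b G′ G)))
  T-inShiftUnion G = mk⇔
    (λ t → let G′ , t′ = any-elim _ (allMats n) t in G′ , to (T-∧ {inM i j a′ b G′}) t′)
    (λ { (G′ , inM-G′ , shift) → any-intro _ (allMats-complete G′) (from (T-∧ {inM i j a′ b G′}) (inM-G′ , shift)) })

  inShiftUnion⇒Realizes : ∀ G → T (inShiftUnion i j a′ a b G) → Realizes a b G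
  inShiftUnion⇒Realizes G t =
    let G′ , _ , shift = to (T-inShiftUnion G) t in proj₁ (to (T-inShift G′ G) shift)

module Correspondence {i j : Fin n} (i≢j : i ≢ j) {a a′ b : Vec ℕ n}
    (a≡ : a ≡ updateAt (updateAt a′ i (λ x → x ∸ 1)) j suc) (gap : lookup a′ j + 2 ≤ lookup a′ i) where

  open Toggle i≢j
  open Transfer i≢j a≡ gap
  open Membership i j a′ a b

  unshift : ∀ {G″ G k″} → ShiftedAt i j G″ G k″ →
    toggle k″ G ≡ G″ × entry G k″ i ≡ false × entry G k″ j ≡ true
  unshift {G″} {G} {k″} (G″k″i , G″k″j , shifted) =
    trans (cong (toggle k″) (sym G″-toggles-to-G)) (toggle-involutive k″ G″) ,
    trans (cong (λ M → entry M k″ i) (sym G″-toggles-to-G)) (trans (entry-toggle-i k″ G″) (cong not G″k″i)) ,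
    trans (cong (λ M → entry M k″ j) (sym G″-toggles-to-G)) (trans (entry-toggle-j k″ G″) (cong not G″k″j))
    where
    G″-toggles-to-G : toggle k″ G″ ≡ G
    G″-toggles-to-G = trans (sym (shiftAt≡toggle G″k″i G″k″j)) shifted

  -- If G is the shift of G″ ∈ M_{i,j}(a′,b) at a row k″ ≠ k, then toggle k G and G″ = toggle k″ G
  -- are (i,j)-adjacent, which puts toggle k G into M_{i,j}(a′,b) as well.
  inM-toggle≡inShiftUnion : ∀ k G → entry G k i ≡ false → entry G k j ≡ true →
    inM i j a′ b (toggle k G) ≡ inShiftUnion i j a′ a b G
  inM-toggle≡inShiftUnion k G Gki Gkj = T-ext forward backward
    where
    forward : T (inM i j a′ b (toggle k G)) → T (inShiftUnion i j a′ a b G)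
    forward t = from (T-inShiftUnion G) (toggle k G , t , from (T-inShift (toggle k G) G)
      (to (Realizes-toggle k G Gki Gkj) (inM⇒Realizes (toggle k G) t) , k ,
       trans (entry-toggle-i k G) (cong not Gki) , trans (entry-toggle-j k G) (cong not Gkj) , shiftAt-toggle Gki Gkj))

    backward : T (inShiftUnion i j a′ a b G) → T (inM i j a′ b (toggle k G))
    backward t with to (T-inShiftUnion G) t
    ... | G″ , inM-G″ , shift with proj₂ (to (T-inShift G″ G) shift)
    ... | k″ , shifted with unshift shifted
    ... | G-toggles-to-G″ , Gk″i , Gk″j with k ≟ᶠ k″
    ...   | yes refl = subst (T ∘ inM i j a′ b) (sym G-toggles-to-G″) inM-G″
    ...   | no k≢k″  = inM-intro (toggle k G) (toggle k″ G)
      (from (Realizes-toggle k G Gki Gkj) (inShiftUnion⇒Realizes G t))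
      (subst (Realizes a′ b) (sym G-toggles-to-G″) (inM⇒Realizes G″ inM-G″))
      (toggle-adjacent {k} {k″} {G} k≢k″ Gki Gkj Gk″i Gk″j)

-- Double counting by strata

module Counting {i j : Fin n} (i≢j : i ≢ j) {a a′ b : Vec ℕ n}
    (a≡ : a ≡ updateAt (updateAt a′ i (λ x → x ∸ 1)) j suc) (gap : lookup a′ j + 2 ≤ lookup a′ i) where

  open Toggle i≢j
  open Transfer i≢j a≡ gap
  open Membership i j a′ a b
  open Correspondence i≢j {b = b} a≡ gap

  common : Mat n → ℕ
  common G = ∑ (allFin n) (λ x → b2n (entry G x i ∧ entry G x j))

  onlyI onlyJ : Mat n → Fin n → Bool
  onlyI G x = entry G x i ∧ not (entry G x j)
  onlyJ G x = not (entry G x i) ∧ entry G x j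

  indeg-i-split : ∀ G → indeg G i ≡ common G + ∑ (allFin n) (b2n ∘ onlyI G)
  indeg-i-split G = trans (∑-cong (allFin n) (λ x → b2n-split-∧ (entry G x i) (entry G x j)))
                          (∑-distrib-+ (allFin n) _ _)

  indeg-j-split : ∀ G → indeg G j ≡ common G + ∑ (allFin n) (b2n ∘ onlyJ G)
  indeg-j-split G = trans (∑-cong (allFin n) (λ x → b2n-split-∧ʳ (entry G x i) (entry G x j)))
                          (∑-distrib-+ (allFin n) _ _)

  common<1+n : ∀ G → common G < suc n
  common<1+n G = s≤s (≤-trans (∑-b2n≤length _ (allFin n)) (≤-reflexive (length-tabulate (λ x → x))))

  M-stratum U-stratum : ℕ → Mat n → Bool
  M-stratum c G = inM i j a′ b G ∧ (common G == c)
  U-stratum c G = inShiftUnion i j a′ a b G ∧ (common G == c)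

  #M #U : ℕ → ℕ
  #M c = ∑ (allMats n) (b2n ∘ M-stratum c)
  #U c = ∑ (allMats n) (b2n ∘ U-stratum c)

  module _ (c : ℕ) (G : Mat n) where

    M-stratum-realizes : T (M-stratum c G) → Realizes a′ b G
    M-stratum-realizes t = inM⇒Realizes G (proj₁ (to (T-∧ {inM i j a′ b G}) t))

    M-stratum-common : T (M-stratum c G) → common G ≡ c
    M-stratum-common t = toWitness (proj₂ (to (T-∧ {inM i j a′ b G}) t))

    U-stratum-realizes : T (U-stratum c G) → Realizes a b G
    U-stratum-realizes t = inShiftUnion⇒Realizes G (proj₁ (to (T-∧ {inShiftUnion i j a′ a b G}) t))

    U-stratum-common : T (U-stratum c G) → common G ≡ c
    U-stratum-common t = toWitness (proj₂ (to (T-∧ {inShiftUnion i j a′ a b G}) t))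

    #onlyI-M : T (M-stratum c G) → ∑ (allFin n) (b2n ∘ onlyI G) ≡ lookup a′ i ∸ c
    #onlyI-M t = sym (begin
      lookup a′ i ∸ c                             ≡⟨ cong (_∸ c) (sym (indeg≡ (M-stratum-realizes t) i)) ⟩
      indeg G i ∸ c                               ≡⟨ cong (_∸ c) (indeg-i-split G) ⟩
      common G + ∑ (allFin n) (b2n ∘ onlyI G) ∸ c ≡⟨ cong (λ d → d + _ ∸ c) (M-stratum-common t) ⟩
      c + ∑ (allFin n) (b2n ∘ onlyI G) ∸ c        ≡⟨ m+n∸m≡n c _ ⟩
      ∑ (allFin n) (b2n ∘ onlyI G)                ∎)
      where open ≡-Reasoning

    #onlyJ-U : T (U-stratum c G) → ∑ (allFin n) (b2n ∘ onlyJ G) ≡ lookup a j ∸ c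
    #onlyJ-U t = sym (begin
      lookup a j ∸ c                              ≡⟨ cong (_∸ c) (sym (indeg≡ (U-stratum-realizes t) j)) ⟩
      indeg G j ∸ c                               ≡⟨ cong (_∸ c) (indeg-j-split G) ⟩
      common G + ∑ (allFin n) (b2n ∘ onlyJ G) ∸ c ≡⟨ cong (λ d → d + _ ∸ c) (U-stratum-common t) ⟩
      c + ∑ (allFin n) (b2n ∘ onlyJ G) ∸ c        ≡⟨ m+n∸m≡n c _ ⟩
      ∑ (allFin n) (b2n ∘ onlyJ G)                ∎)
      where open ≡-Reasoning

    -- a_j = a′_j + 1 < a′_i, and c ≤ a′_j since the c common in-neighbours of i and j are in-neighbours of j.
    stratum-gap : T (M-stratum c G) → lookup a j ∸ c < lookup a′ i ∸ c
    stratum-gap t = begin-strict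
      lookup a j ∸ c             ≡⟨ cong (_∸ c) lookup-j ⟩
      1 + lookup a′ j ∸ c        ≡⟨ +-∸-assoc 1 c≤a′ⱼ ⟩
      1 + (lookup a′ j ∸ c)      <⟨ n<1+n _ ⟩
      2 + (lookup a′ j ∸ c)      ≡⟨ sym (+-∸-assoc 2 c≤a′ⱼ) ⟩
      2 + lookup a′ j ∸ c        ≡⟨ cong (_∸ c) (+-comm 2 (lookup a′ j)) ⟩
      lookup a′ j + 2 ∸ c        ≤⟨ ∸-monoˡ-≤ c gap ⟩
      lookup a′ i ∸ c            ∎
      where
      open ≤-Reasoning
      c≤a′ⱼ : c ≤ lookup a′ j
      c≤a′ⱼ = subst (c ≤_) c+#onlyJ≡a′ⱼ (m≤m+n c _)
        where
        c+#onlyJ≡a′ⱼ : c + ∑ (allFin n) (b2n ∘ onlyJ G) ≡ lookup a′ j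
        c+#onlyJ≡a′ⱼ = trans (cong (_+ _) (sym (M-stratum-common t)))
                             (trans (sym (indeg-j-split G)) (indeg≡ (M-stratum-realizes t) j))

  common-toggle : ∀ k G → entry G k i ≡ false → entry G k j ≡ true → common (toggle k G) ≡ common G
  common-toggle k G Gki Gkj = ∑-cong (allFin n) both
    where
    both : ∀ x → b2n (entry (toggle k G) x i ∧ entry (toggle k G) x j) ≡ b2n (entry G x i ∧ entry G x j)
    both x with x ≟ᶠ k
    ... | yes refl rewrite entry-toggle-i x G | entry-toggle-j x G | Gki | Gkj = refl
    ... | no x≢k   rewrite entry-toggle-row k G i x≢k | entry-toggle-row k G j x≢k = refl

  onlyI-toggle : ∀ k G → onlyI (toggle k G) k ≡ onlyJ G k
  onlyI-toggle k G rewrite entry-toggle-i k G | entry-toggle-j k G | not-involutive (entry G k j) = refl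

  stratum-toggle : ∀ c k G → M-stratum c (toggle k G) ∧ onlyI (toggle k G) k ≡ U-stratum c G ∧ onlyJ G k
  stratum-toggle c k G rewrite onlyI-toggle k G = ∧-congʳ-T (onlyJ G k) same-stratum
    where
    same-stratum : T (onlyJ G k) → M-stratum c (toggle k G) ≡ U-stratum c G
    same-stratum t =
      let ki , kj = to (T-∧ {not (entry G k i)}) t
          Gki = to T-not-≡ ki
          Gkj = to T-≡ kj
      in cong₂ _∧_ (inM-toggle≡inShiftUnion k G Gki Gkj) (cong (_== c) (common-toggle k G Gki Gkj))

  stratum-balance : ∀ c → #M c * (lookup a′ i ∸ c) ≡ #U c * (lookup a j ∸ c)
  stratum-balance c = begin
    #M c * (lookup a′ i ∸ c)
      ≡⟨ sym (∑-incidences (allMats n) (allFin n) (M-stratum c) onlyI _ (#onlyI-M c)) ⟩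
    ∑ (allFin n) (λ k → ∑ (allMats n) (λ G → b2n (M-stratum c G ∧ onlyI G k)))
      ≡⟨ ∑-cong (allFin n) toggle-rows ⟩
    ∑ (allFin n) (λ k → ∑ (allMats n) (λ G → b2n (U-stratum c G ∧ onlyJ G k)))
      ≡⟨ ∑-incidences (allMats n) (allFin n) (U-stratum c) onlyJ _ (#onlyJ-U c) ⟩
    #U c * (lookup a j ∸ c)
      ∎
    where
    open ≡-Reasoning
    toggle-rows : ∀ k → ∑ (allMats n) (λ G → b2n (M-stratum c G ∧ onlyI G k))
                      ≡ ∑ (allMats n) (λ G → b2n (U-stratum c G ∧ onlyJ G k))
    toggle-rows k = trans (sym (toggle-SumInvariant k (λ G → b2n (M-stratum c G ∧ onlyI G k))))
                          (∑-cong (allMats n) (λ G → cong b2n (stratum-toggle c k G)))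

  #M<#U : ∀ c G → T (M-stratum c G) → #M c < #U c
  #M<#U c G t = balance⇒< (stratum-balance c) (stratum-gap c G t)
    (subst (_≤ #M c) (cong b2n (to T-≡ t)) (∈⇒≤∑ (b2n ∘ M-stratum c) (allMats-complete G)))

  #M≤#U : ∀ c → #M c ≤ #U c
  #M≤#U c with #M c ℕ.≟ 0
  ... | yes #M≡0 = subst (_≤ #U c) (sym #M≡0) z≤n
  ... | no  #M≢0 = let G , t = ∑-b2n>0⇒∃ (M-stratum c) (allMats n) (n≢0⇒n>0 #M≢0)
                   in <⇒≤ (#M<#U c G t)

  cardM<cardShiftUnion : Σ (Mat n) (T ∘ inM i j a′ b) → cardM i j a′ b < cardShiftUnion i j a′ a b
  cardM<cardShiftUnion (W , inM-W) = begin-strict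
    cardM i j a′ b                                ≡⟨ length-filterᵇ _ (allMats n) ⟩
    ∑ (allMats n) (b2n ∘ inM i j a′ b)            ≡⟨ ∑-stratify (allMats n) _ common (suc n) common<1+n ⟩
    ∑ (allFin (suc n)) (#M ∘ toℕ)
      <⟨ ∑-mono-< (#M≤#U ∘ toℕ) (∈-allFin c) (#M<#U (toℕ c) W W∈stratum) ⟩
    ∑ (allFin (suc n)) (#U ∘ toℕ)                 ≡⟨ sym (∑-stratify (allMats n) _ common (suc n) common<1+n) ⟩
    ∑ (allMats n) (b2n ∘ inShiftUnion i j a′ a b) ≡⟨ sym (length-filterᵇ _ (allMats n)) ⟩
    cardShiftUnion i j a′ a b                     ∎
    where
    open ≤-Reasoning
    c : Fin (suc n)
    c = fromℕ< (common<1+n W)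
    W∈stratum : T (M-stratum (toℕ c) W)
    W∈stratum = from (T-∧ {inM i j a′ b W}) (inM-W , fromWitness (sym (Fin.toℕ-fromℕ< (common<1+n W))))

proposition4 : ∀ (n : ℕ) (a a' b : Vec ℕ n) (i j : Fin n) →
    a ≢ a' → LoopDigraphic a b → LoopDigraphic a' b →
    UnitTransfer i j a' a →
    Σ (Mat n) (λ G' → T (inM i j a' b G')) →
    cardM i j a' b < cardShiftUnion i j a' a b
proposition4 n a a' b i j _ _ _ (i<j , gap , a≡) =
  Counting.cardM<cardShiftUnion (Fin.<⇒≢ i<j) {b = b} a≡ gap
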